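{- For any positive integers $n$ and $s$ with $n\ge 3$ and $s\ge 2$, we have $c(K_n)=1$ and $c_{s,s}(K_n^{(s)})=2$.
   Context: All graphs are finite, undirected and reflexive (a player may stay put). In the speed-$(s,s)$ Cops and Robbers game on a graph $G$, the cops first place themselves on vertices, then the robber places himself; play proceeds in rounds, each a cops' turn followed by a robber's turn. On the cops' turn each cop moves along a walk of length at most $s$ (possibly staying put); on the robber's turn he moves along a walk of length at most $s$ not passing through a cop-occupied vertex. The cops win if some cop occupies the robber's vertex; the robber wins if he evades forever. $c_{s,s}(G)$ is the minimum number of cops guaranteeing a win, and $c(G)=c_{1,1}(G)$ is the ordinary cop number. $K_n^{(s)}$ is the graph obtained from the complete graph $K_n$ by subdividing each edge $s-1$ times (replacing each edge by a path of length $s$). -}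

module Defs where

open import Data.Nat using (ℕ; zero; suc; _+_; _∸_; _≤_; _<_)
open import Data.Fin using (Fin; toℕ)
import Data.Fin as F
open import Data.Product using (Σ; ∃; _×_; _,_)
open import Data.Sum using (_⊎_)
open import Data.Unit using (⊤)
open import Relation.Nullary using (¬_)
open import Relation.Binary.PropositionalEquality using (_≡_)

record Graph : Set₁ where
  field
    V     : Set
    _~_   : V → V → Set
    ~-refl : ∀ v → v ~ v
    ~-sym  : ∀ {u v} → u ~ v → v ~ u

module _ (G : Graph) where
  open Graph G

  data Walk (P : V → Set) : ℕ → V → V → Set where
    here : ∀ {v} → P v → Walk P zero v v
    step : ∀ {l u w v} → P u → u ~ w → Walk P l w v → Walk P (suc l) u v

  Reach : (P : V → Set) → ℕ → V → V → Set
  Reach P s u v = Σ ℕ λ l → l ≤ s × Walk P l u v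

  Cops : ℕ → Set
  Cops k = Fin k → V

  Caught : ∀ {k} → Cops k → V → Set
  Caught cs r = Σ (Fin _) λ i → cs i ≡ r

  -- Cops (speed s), with cops at cs and robber at r, and the cops to move,
  -- can force capture.  (Inductive = winning region of the reachability game.)
  data CopsForce (s k : ℕ) : Cops k → V → Set where
    move : ∀ {cs r} (cs' : Cops k) →
           (∀ i → Reach (λ _ → ⊤) s (cs i) (cs' i)) →
           (Caught cs' r ⊎
            (∀ r' → Reach (λ v → ¬ Caught cs' v) s r r' → CopsForce s k cs' r')) →
           CopsForce s k cs r

  CopsWin : ℕ → ℕ → Set
  CopsWin s k = Σ (Cops k) λ cs → ∀ r → Caught cs r ⊎ CopsForce s k cs r

  CopNumberIs : ℕ → ℕ → Set
  CopNumberIs s k = CopsWin s k × (∀ j → j < k → ¬ CopsWin s j)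

CopNumber≡ : Graph → ℕ → Set
CopNumber≡ G k = CopNumberIs G 1 k

K : ℕ → Graph
K n = record { V = Fin n ; _~_ = λ _ _ → ⊤ ; ~-refl = λ _ → _ ; ~-sym = λ _ → _ }

-- K_n^{(s)}: each edge {i,j} (i < j) of K_n replaced by a path
-- i = p₀, p₁, …, p_{s-1}, p_s = j with s-1 new internal vertices
-- (mid i j h t) = p_{t+1}, t = 0 … s-2.

data SubV (n s : ℕ) : Set where
  orig : Fin n → SubV n s
  mid  : (i j : Fin n) → i F.< j → Fin (s ∸ 1) → SubV n s

data SubE (n s : ℕ) : SubV n s → SubV n s → Set where
  e-direct : ∀ {i j} → i F.< j → s ≡ 1 → SubE n s (orig i) (orig j)
  e-start  : ∀ {i j} (h : i F.< j) (t : Fin (s ∸ 1)) → toℕ t ≡ 0 →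
             SubE n s (orig i) (mid i j h t)
  e-mid    : ∀ {i j} (h : i F.< j) (t t' : Fin (s ∸ 1)) → toℕ t' ≡ suc (toℕ t) →
             SubE n s (mid i j h t) (mid i j h t')
  e-end    : ∀ {i j} (h : i F.< j) (t : Fin (s ∸ 1)) → toℕ t + 2 ≡ s →
             SubE n s (mid i j h t) (orig j)

data SubAdj (n s : ℕ) : SubV n s → SubV n s → Set where
  loop : ∀ v → SubAdj n s v v
  fwd  : ∀ {u v} → SubE n s u v → SubAdj n s u v
  bwd  : ∀ {u v} → SubE n s v u → SubAdj n s u v

Subdiv : ℕ → ℕ → Graph
Subdiv n s = record
  { V = SubV n s ; _~_ = SubAdj n s ; ~-refl = loop
  ; ~-sym = λ { (loop v) → loop v ; (fwd e) → bwd e ; (bwd e) → fwd e } }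

{-# OPTIONS --safe #-}
-- One cop on K_n simply jumps onto the robber.  On K_n^(s) two cops first occupy both ends of
-- the robber's subdivided edge, which traps him inside it, and then one of them walks in.
-- Against a single cop the robber keeps the invariant that the positions of cop and robber touch
-- no common branch vertex and are not both branch vertices.  A cop in such a position is more
-- than s steps away from the robber's branch vertex, resp. from the interior of the robber's edge:
-- this is witnessed by 1-Lipschitz potentials, built from the distance to branch vertices, that
-- exceed s at the cop and vanish at the target.  Hence after every cop move the robber can stay,
-- or run off his edge away from the cop, or leave his branch vertex towards a third branch
-- vertex (here n ≥ 3 is used), and so restore the invariant.
module Submission where

open import Defs
open import Data.Nat using (ℕ; zero; suc; _+_; _∸_; _≤_; _<_; _⊓_; z≤n; s≤s)
open import Data.Nat.Properties
  using ( ≤-refl; ≤-reflexive; ≤-trans; <⇒≱; n≤1+n; m≤m+n; m≤n+m; module ≤-Reasoning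
        ; +-comm; +-identityʳ; +-cancelʳ-≡; +-mono-≤; +-monoˡ-≤
        ; m∸n≤m; +-∸-assoc; m+n∸n≡m; ∸-monoʳ-≤; m<n⇒0<n∸m
        ; ⊓-glb; ⊓-mono-≤; m≤n⇒m⊓o≤n; m≤n⇒o⊓m≤n )
open import Data.Fin as F using (Fin; toℕ; inject₁; fromℕ; _≟_)
import Data.Fin.Properties as FinP
open import Data.Fin.Induction using (<-weakInduction; >-weakInduction)
open import Data.Product using (∃; _×_; _,_; proj₁)
open import Data.Sum using (_⊎_; inj₁; inj₂; [_,_])
open import Data.Unit using (⊤; tt)
open import Data.Empty using (⊥-elim)
open import Relation.Nullary using (¬_; Dec; yes; no)
open import Relation.Nullary.Decidable using (_⊎-dec_)
open import Relation.Unary using (Decidable)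
open import Relation.Binary using (tri<; tri≈; tri>)
open import Relation.Binary.PropositionalEquality using (_≡_; _≢_; refl; sym; trans; cong; subst)

module Walks (G : Graph) where
  open Graph G

  private variable
    P Q : V → Set
    a b l l' : ℕ
    u v w : V

  snoc : Walk G P l u v → v ~ w → P w → Walk G P (suc l) u w
  snoc (here p) e q = step p e (here q)
  snoc (step p e ws) e' q = step p e (snoc ws e' q)

  reverse : Walk G P l u v → Walk G P l v u
  reverse (here p) = here p
  reverse (step p e ws) = snoc (reverse ws) (~-sym e) p

  _++_ : Walk G P l u v → Walk G P l' v w → Walk G P (l + l') u w
  here _ ++ ws' = ws'
  step p e ws ++ ws' = step p e (ws ++ ws')

  map : (∀ {x} → P x → Q x) → Walk G P l u v → Walk G Q l u v
  map f (here p) = here (f p)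
  map f (step p e ws) = step (f p) e (map f ws)

  source : Walk G P l u v → P u
  source (here p) = p
  source (step p _ _) = p

  reach-stay : P u → Reach G P a u u
  reach-stay p = 0 , z≤n , here p

  reach-edge : P u → u ~ w → P w → Reach G P 1 u w
  reach-edge p e q = 1 , ≤-refl , step p e (here q)

  reach-snoc : Reach G P a u v → v ~ w → P w → Reach G P (suc a) u w
  reach-snoc (l , l≤a , ws) e q = suc l , s≤s l≤a , snoc ws e q

  reach-trans : Reach G P a u v → Reach G P b v w → Reach G P (a + b) u w
  reach-trans (l , l≤a , ws) (l' , l'≤b , ws') = l + l' , +-mono-≤ l≤a l'≤b , ws ++ ws'

  reach-sym : Reach G P a u v → Reach G P a v u
  reach-sym (l , l≤a , ws) = l , l≤a , reverse ws

  reach-weaken : a ≤ b → Reach G P a u v → Reach G P b u v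
  reach-weaken a≤b (l , l≤a , ws) = l , ≤-trans l≤a a≤b , ws

  reach-map : (∀ {x} → P x → Q x) → Reach G P a u v → Reach G Q a u v
  reach-map f (l , l≤a , ws) = l , l≤a , map f ws

  reach-source : Reach G P a u v → P u
  reach-source (_ , _ , ws) = source ws

  Lipschitz : (V → ℕ) → Set
  Lipschitz f = ∀ {u w} → u ~ w → f u ≤ suc (f w)

  lipschitz-walk : ∀ {f} → Lipschitz f → Walk G P l u v → f u ≤ l + f v
  lipschitz-walk lip (here _) = ≤-refl
  lipschitz-walk lip (step _ e ws) = ≤-trans (lip e) (s≤s (lipschitz-walk lip ws))

  lipschitz-unreachable : ∀ {f} → Lipschitz f → a < f u → f v ≡ 0 → ¬ Reach G P a u v
  lipschitz-unreachable {a = a} {u = u} {v = v} {f = f} lip a<fu fv≡0 (l , l≤a , ws) = <⇒≱ a<fu (begin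
    f u     ≤⟨ lipschitz-walk lip ws ⟩
    l + f v ≡⟨ cong (l +_) fv≡0 ⟩
    l + 0   ≡⟨ +-identityʳ l ⟩
    l       ≤⟨ l≤a ⟩
    a       ∎)
    where open ≤-Reasoning

  module _ {S : V → Set} (S? : Decidable S) where

    zeroOn : (V → ℕ) → V → ℕ
    zeroOn f v with S? v
    ... | yes _ = 0
    ... | no _ = suc (f v)

    zeroOn-inside : ∀ {f} → S v → zeroOn f v ≡ 0
    zeroOn-inside {v} Sv with S? v
    ... | yes _ = refl
    ... | no ¬Sv = ⊥-elim (¬Sv Sv)

    zeroOn-outside : ∀ {f} → ¬ S v → zeroOn f v ≡ suc (f v)
    zeroOn-outside {v} ¬Sv with S? v
    ... | yes Sv = ⊥-elim (¬Sv Sv)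
    ... | no _ = refl

    zeroOn-lipschitz : ∀ {f} → Lipschitz f → (∀ {u w} → S u → ¬ S w → u ~ w → f w ≡ 0) →
                       Lipschitz (zeroOn f)
    zeroOn-lipschitz lip boundary {u} {w} e with S? u | S? w
    ... | yes _  | _     = z≤n
    ... | no ¬Su | yes Sw = s≤s (≤-reflexive (boundary Sw ¬Su (~-sym e)))
    ... | no _   | no _  = s≤s (lip e)

  no-cops-lose : ∀ {s} → V → ¬ CopsWin G s 0
  no-cops-lose {s} v (_ , strategy) with strategy v
  ... | inj₁ (() , _)
  ... | inj₂ force = robber-stays force
    where
    robber-stays : ∀ {cs r} → ¬ CopsForce G s 0 cs r
    robber-stays (move _ _ (inj₁ (() , _)))
    robber-stays {r = r} (move _ _ (inj₂ continue)) = robber-stays (continue r (reach-stay λ { (() , _) }))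

open Walks

complete-copNumber : ∀ n → CopNumber≡ (K (suc n)) 1
complete-copNumber n = ((λ _ → F.zero) , chase) , fewer-lose
  where
  chase : ∀ r → Caught (K (suc n)) (λ _ → F.zero) r ⊎ CopsForce (K (suc n)) 1 1 (λ _ → F.zero) r
  chase r = inj₂ (move (λ _ → r) (λ _ → reach-edge (K (suc n)) tt tt tt) (inj₁ (F.zero , refl)))
  fewer-lose : ∀ j → j < 1 → ¬ CopsWin (K (suc n)) 1 j
  fewer-lose zero _ = no-cops-lose (K (suc n)) F.zero
  fewer-lose (suc _) (s≤s ())

avoid-two : ∀ {n} → 3 ≤ n → (a b : Fin n) → ∃ λ v → a ≢ v × b ≢ v
avoid-two (s≤s (s≤s (s≤s _))) F.zero F.zero = F.suc F.zero , (λ ()) , (λ ())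
avoid-two (s≤s (s≤s (s≤s _))) F.zero (F.suc F.zero) = F.suc (F.suc F.zero) , (λ ()) , (λ ())
avoid-two (s≤s (s≤s (s≤s _))) F.zero (F.suc (F.suc _)) = F.suc F.zero , (λ ()) , (λ ())
avoid-two (s≤s (s≤s (s≤s _))) (F.suc F.zero) F.zero = F.suc (F.suc F.zero) , (λ ()) , (λ ())
avoid-two (s≤s (s≤s (s≤s _))) (F.suc F.zero) (F.suc _) = F.zero , (λ ()) , (λ ())
avoid-two (s≤s (s≤s (s≤s _))) (F.suc (F.suc _)) F.zero = F.suc F.zero , (λ ()) , (λ ())
avoid-two (s≤s (s≤s (s≤s _))) (F.suc (F.suc _)) (F.suc _) = F.zero , (λ ()) , (λ ())

m∸n≤1+m∸1+n : ∀ m n → m ∸ n ≤ suc (m ∸ suc n)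
m∸n≤1+m∸1+n zero zero = z≤n
m∸n≤1+m∸1+n zero (suc n) = z≤n
m∸n≤1+m∸1+n (suc m) zero = ≤-refl
m∸n≤1+m∸1+n (suc m) (suc n) = m∸n≤1+m∸1+n m n

⊓-glb-suc : ∀ {m n o} → o ≤ suc m → o ≤ suc n → o ≤ suc (m ⊓ n)
⊓-glb-suc {m} {n} = ⊓-glb {y = suc m} {z = suc n}

module Subdivision (n k : ℕ) where

  s : ℕ
  s = suc (suc k)

  G : Graph
  G = Subdiv n s

  open Graph G using (V; _~_)

  private variable
    P : V → Set
    X Y a b i j y : Fin n
    u w c r : V

  toℕ-fromℕ+2≡s : toℕ (fromℕ k) + 2 ≡ s
  toℕ-fromℕ+2≡s = trans (cong (_+ 2) (FinP.toℕ-fromℕ k)) (+-comm k 2)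

  toℕ+2≡s⇒toℕ≡k : ∀ {t : Fin (suc k)} → toℕ t + 2 ≡ s → toℕ t ≡ k
  toℕ+2≡s⇒toℕ≡k {t} eq = +-cancelʳ-≡ 2 (toℕ t) k (trans eq (+-comm 2 k))

  module _ (h : X F.< Y) where

    mid-step : ∀ (t : Fin k) → mid X Y h (inject₁ t) ~ mid X Y h (F.suc t)
    mid-step t = fwd (e-mid h _ _ (cong suc (sym (FinP.toℕ-inject₁ t))))

    along-from-start : P (orig X) → (∀ t → P (mid X Y h t)) →
                       ∀ t → Reach G P (suc (toℕ t)) (orig X) (mid X Y h t)
    along-from-start {P} pX pMid = <-weakInduction Goal first next
      where
      Goal : Fin (suc k) → Set
      Goal t = Reach G P (suc (toℕ t)) (orig X) (mid X Y h t)
      first : Goal F.zero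
      first = reach-edge G pX (fwd (e-start h F.zero refl)) (pMid F.zero)
      next : ∀ t → Goal (inject₁ t) → Goal (F.suc t)
      next t goal = reach-weaken G (≤-reflexive (cong (λ m → suc (suc m)) (FinP.toℕ-inject₁ t)))
        (reach-snoc G goal (mid-step t) (pMid _))

    along-to-end : P (orig Y) → (∀ t → P (mid X Y h t)) →
                   ∀ t → Reach G P (suc k ∸ toℕ t) (mid X Y h t) (orig Y)
    along-to-end {P} pY pMid = >-weakInduction Goal last previous
      where
      Goal : Fin (suc k) → Set
      Goal t = Reach G P (suc k ∸ toℕ t) (mid X Y h t) (orig Y)
      last : Goal (fromℕ k)
      last = reach-weaken G (≤-reflexive (sym distance))
        (reach-edge G (pMid _) (fwd (e-end h (fromℕ k) toℕ-fromℕ+2≡s)) pY)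
        where
        distance : suc k ∸ toℕ (fromℕ k) ≡ 1
        distance = trans (cong (suc k ∸_) (FinP.toℕ-fromℕ k)) (m+n∸n≡m 1 k)
      previous : ∀ t → Goal (F.suc t) → Goal (inject₁ t)
      previous t goal = reach-weaken G (≤-reflexive (sym distance))
        (reach-trans G (reach-edge G (pMid _) (mid-step t) (pMid _)) goal)
        where
        distance : suc k ∸ toℕ (inject₁ t) ≡ suc (k ∸ toℕ t)
        distance = trans (cong (suc k ∸_) (FinP.toℕ-inject₁ t)) (+-∸-assoc 1 (FinP.toℕ≤n t))

    across< : P (orig X) → P (orig Y) → (∀ t → P (mid X Y h t)) → Reach G P s (orig X) (orig Y)
    across< pX pY pMid = reach-trans G (along-from-start pX pMid F.zero) (along-to-end pY pMid F.zero)

  Touches : V → Fin n → Set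
  Touches (orig i) x = i ≡ x
  Touches (mid i j _ _) x = i ≡ x ⊎ j ≡ x

  touches? : ∀ v x → Dec (Touches v x)
  touches? (orig i) x = i ≟ x
  touches? (mid i j _ _) x = (i ≟ x) ⊎-dec (j ≟ x)

  touches-some : ∀ v → ∃ (Touches v)
  touches-some (orig i) = i , refl
  touches-some (mid i _ _ _) = i , inj₁ refl

  untouched⇒≢ : ∀ {x} → ¬ Touches c x → Touches w x → c ≢ w
  untouched⇒≢ ¬cx wx refl = ¬cx wx

  record Disjoint (c r : V) : Set where
    constructor disjoint
    field apart : ∀ {x} → Touches c x → ¬ Touches r x
  open Disjoint

  disjoint⇒≢ : Disjoint c r → c ≢ r
  disjoint⇒≢ {r = r} d refl = let (x , rx) = touches-some r in apart d rx rx

  disjoint-orig : ¬ Touches c y → Disjoint c (orig y)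
  disjoint-orig ¬cy = disjoint λ { cx refl → ¬cy cx }

  disjoint-mid : ∀ {h t} → ¬ Touches c i → ¬ Touches c j → Disjoint c (mid i j h t)
  disjoint-mid ¬ci ¬cj = disjoint λ { cx (inj₁ refl) → ¬ci cx ; cx (inj₂ refl) → ¬cj cx }

  data IsMid : V → Set where
    is-mid : ∀ {h t} → IsMid (mid i j h t)

  data OnEdge (X Y : Fin n) : V → Set where
    on-edge : ∀ h t → OnEdge X Y (mid X Y h t)

  onEdge? : ∀ X Y → Decidable (OnEdge X Y)
  onEdge? X Y (orig _) = no λ ()
  onEdge? X Y (mid a b h t) with a ≟ X | b ≟ Y
  ... | yes refl | yes refl = yes (on-edge h t)
  ... | no a≢X   | _        = no λ { (on-edge _ _) → a≢X refl }
  ... | yes _    | no b≢Y   = no λ { (on-edge _ _) → b≢Y refl }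

  off-edge⇒≢ : ∀ {h} → ¬ OnEdge X Y c → ∀ t → c ≢ mid X Y h t
  off-edge⇒≢ {h = h} off t refl = off (on-edge h t)

  edge-neighbour : OnEdge X Y u → u ~ w → OnEdge X Y w ⊎ (w ≡ orig X ⊎ w ≡ orig Y)
  edge-neighbour (on-edge h t) (loop _) = inj₁ (on-edge h t)
  edge-neighbour (on-edge h _) (fwd (e-mid _ _ t' _)) = inj₁ (on-edge h t')
  edge-neighbour (on-edge _ _) (fwd (e-end _ _ _)) = inj₂ (inj₂ refl)
  edge-neighbour (on-edge _ _) (bwd (e-start _ _ _)) = inj₂ (inj₁ refl)
  edge-neighbour (on-edge h _) (bwd (e-mid _ t' _ _)) = inj₁ (on-edge h t')

  trapped-on-edge : ∀ {l} → ¬ P (orig X) → ¬ P (orig Y) → OnEdge X Y u → Walk G P l u w → OnEdge X Y w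
  trapped-on-edge ¬pX ¬pY on (here _) = on
  trapped-on-edge ¬pX ¬pY on (step _ e ws) with edge-neighbour on e
  ... | inj₁ on' = trapped-on-edge ¬pX ¬pY on' ws
  ... | inj₂ (inj₁ refl) = ⊥-elim (¬pX (source G ws))
  ... | inj₂ (inj₂ refl) = ⊥-elim (¬pY (source G ws))

  touches-both⇒onEdge : X F.< Y → Touches c X → Touches c Y → OnEdge X Y c
  touches-both⇒onEdge {c = orig _} X<Y refl refl = ⊥-elim (FinP.<-irrefl refl X<Y)
  touches-both⇒onEdge {c = mid _ _ h t} X<Y (inj₁ refl) (inj₂ refl) = on-edge h t
  touches-both⇒onEdge {c = mid _ _ _ _} X<Y (inj₁ refl) (inj₁ refl) = ⊥-elim (FinP.<-irrefl refl X<Y)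
  touches-both⇒onEdge {c = mid _ _ _ _} X<Y (inj₂ refl) (inj₂ refl) = ⊥-elim (FinP.<-irrefl refl X<Y)
  touches-both⇒onEdge {c = mid _ _ h _} X<Y (inj₂ refl) (inj₁ refl) = ⊥-elim (FinP.<-asym h X<Y)

  across : i ≢ j → P (orig i) → (∀ {w} → Touches w j → P w) → Reach G P s (orig i) (orig j)
  across {i} {j} i≢j pi pTouch with FinP.<-cmp i j
  ... | tri< i<j _ _ = across< i<j pi (pTouch refl) (λ _ → pTouch (inj₂ refl))
  ... | tri≈ _ i≡j _ = ⊥-elim (i≢j i≡j)
  ... | tri> _ _ j<i = reach-sym G (across< j<i (pTouch refl) pi (λ _ → pTouch (inj₁ refl)))

  branch-reach : ∀ i j → Reach G (λ _ → ⊤) s (orig i) (orig j)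
  branch-reach i j with i ≟ j
  ... | yes refl = reach-stay G tt
  ... | no i≢j = across i≢j tt (λ _ → tt)

  two-cops-win : Fin n → CopsWin G s 2
  two-cops-win z = (λ _ → orig z) , strategy
    where
    strategy : ∀ r → Caught G (λ _ → orig z) r ⊎ CopsForce G s 2 (λ _ → orig z) r
    strategy (orig y) = inj₂ (move (λ _ → orig y) (λ _ → branch-reach z y) (inj₁ (F.zero , refl)))
    strategy (mid i j h t) =
      inj₂ (move ends (λ { F.zero → branch-reach z i ; (F.suc _) → branch-reach z j }) (inj₂ close-in))
      where
      ends : Cops G 2
      ends F.zero = orig i
      ends (F.suc _) = orig j
      close-in : ∀ r' → Reach G (λ v → ¬ Caught G ends v) s (mid i j h t) r' → CopsForce G s 2 ends r'
      close-in r' (_ , _ , ws)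
        with trapped-on-edge (λ free → free (F.zero , refl)) (λ free → free (F.suc F.zero , refl)) (on-edge h t) ws
      ... | on-edge h' t' = move capture moves (inj₁ (F.zero , refl))
        where
        capture : Cops G 2
        capture F.zero = mid i j h' t'
        capture (F.suc _) = orig j
        moves : ∀ c → Reach G (λ _ → ⊤) s (ends c) (capture c)
        moves F.zero = reach-weaken G (≤-trans (FinP.toℕ<n t') (n≤1+n _)) (along-from-start h' tt (λ _ → tt) t')
        moves (F.suc _) = reach-stay G tt

  -- From mid i j _ t one reaches i in toℕ t + 1 steps and j in s ∸ 1 ∸ toℕ t = suc k ∸ toℕ t steps.
  extend : (Fin n → ℕ) → V → ℕ
  extend F (orig i) = F i
  extend F (mid i j _ t) = (suc (toℕ t) + F i) ⊓ (suc k ∸ toℕ t + F j)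

  extend-lipschitz : ∀ {F} → (∀ p q → F p ≤ s + F q) → Lipschitz G (extend F)
  extend-lipschitz _ (loop _) = n≤1+n _
  extend-lipschitz L (fwd (e-start {i} {j} _ _ t≡0)) rewrite t≡0 =
    ⊓-glb-suc (≤-trans (n≤1+n _) (n≤1+n _)) (L i j)
  extend-lipschitz _ (bwd (e-start _ _ t≡0)) rewrite t≡0 = m≤n⇒m⊓o≤n _ ≤-refl
  extend-lipschitz {F} _ (fwd (e-mid {j = j} _ t _ t'≡1+t)) rewrite t'≡1+t =
    ⊓-mono-≤ (≤-trans (n≤1+n _) (n≤1+n _)) (+-monoˡ-≤ (F j) (m∸n≤1+m∸1+n (suc k) (toℕ t)))
  extend-lipschitz {F} _ (bwd (e-mid {j = j} _ t _ t'≡1+t)) rewrite t'≡1+t =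
    ⊓-mono-≤ ≤-refl (≤-trans (+-monoˡ-≤ (F j) (∸-monoʳ-≤ (suc k) (n≤1+n (toℕ t)))) (n≤1+n _))
  extend-lipschitz {F} _ (fwd (e-end {j = j} _ _ end)) rewrite toℕ+2≡s⇒toℕ≡k end =
    m≤n⇒o⊓m≤n _ (≤-reflexive (cong (_+ F j) (m+n∸n≡m 1 k)))
  extend-lipschitz {F} L (bwd (e-end {i} {j} _ _ end)) rewrite toℕ+2≡s⇒toℕ≡k end =
    ⊓-glb-suc (L j i) (≤-trans (m≤n+m (F j) _) (n≤1+n _))

  endWeight : V → Fin n → ℕ
  endWeight r x with touches? r x
  ... | yes _ = 0
  ... | no _ = s

  endWeight-≤ : ∀ r x → endWeight r x ≤ s
  endWeight-≤ r x with touches? r x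
  ... | yes _ = z≤n
  ... | no _ = ≤-refl

  endWeight-touch : ∀ {x} → Touches r x → endWeight r x ≡ 0
  endWeight-touch {r} {x} rx with touches? r x
  ... | yes _ = refl
  ... | no ¬rx = ⊥-elim (¬rx rx)

  endWeight-far : ∀ {x} → ¬ Touches r x → endWeight r x ≡ s
  endWeight-far {r} {x} ¬rx with touches? r x
  ... | yes rx = ⊥-elim (¬rx rx)
  ... | no _ = refl

  distToEnds : V → V → ℕ
  distToEnds r = extend (endWeight r)

  distToEnds-lipschitz : ∀ r → Lipschitz G (distToEnds r)
  distToEnds-lipschitz r = extend-lipschitz (λ p q → ≤-trans (endWeight-≤ r p) (m≤m+n s _))

  distToEnds-disjoint-mid : ∀ {h t} → Disjoint (mid a b h t) r → suc s ≤ distToEnds r (mid a b h t)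
  distToEnds-disjoint-mid {a = a} {b = b} {r = r} {t = t} d = ⊓-glb via-a via-b
    where
    via-a : suc s ≤ suc (toℕ t) + endWeight r a
    via-a = subst (λ m → suc s ≤ suc (toℕ t) + m) (sym (endWeight-far (apart d (inj₁ refl)))) (s≤s (m≤n+m s (toℕ t)))
    via-b : suc s ≤ suc k ∸ toℕ t + endWeight r b
    via-b = subst (λ m → suc s ≤ suc k ∸ toℕ t + m) (sym (endWeight-far (apart d (inj₂ refl))))
                  (+-monoˡ-≤ s (m<n⇒0<n∸m (FinP.toℕ<n t)))

  distToEnds-disjoint : Disjoint c r → s ≤ distToEnds r c
  distToEnds-disjoint {orig _} d = ≤-reflexive (sym (endWeight-far (apart d refl)))
  distToEnds-disjoint {mid _ _ _ _} d = ≤-trans (n≤1+n s) (distToEnds-disjoint-mid d)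

  cop-misses-branch : IsMid c → Disjoint c (orig y) → Reach G P s c w → w ≢ orig y
  cop-misses-branch {y = y} is-mid d cop-move refl =
    lipschitz-unreachable G (distToEnds-lipschitz (orig y)) (distToEnds-disjoint-mid d) (endWeight-touch refl) cop-move

  cop-misses-edge : ∀ {h t} → Disjoint c (mid X Y h t) → Reach G P s c w → ¬ OnEdge X Y w
  cop-misses-edge {c} {X} {Y} {h = h} {t} d cop-move on =
    lipschitz-unreachable G φ-lipschitz s<φc (zeroOn-inside G (onEdge? X Y) {f = distToEnds robber} on) cop-move
    where
    robber : V
    robber = mid X Y h t
    φ-lipschitz : Lipschitz G (zeroOn G (onEdge? X Y) (distToEnds robber))
    φ-lipschitz = zeroOn-lipschitz G (onEdge? X Y) (distToEnds-lipschitz robber) boundary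
      where
      boundary : ∀ {u w} → OnEdge X Y u → ¬ OnEdge X Y w → u ~ w → distToEnds robber w ≡ 0
      boundary on off e with edge-neighbour on e
      ... | inj₁ on' = ⊥-elim (off on')
      ... | inj₂ (inj₁ refl) = endWeight-touch (inj₁ refl)
      ... | inj₂ (inj₂ refl) = endWeight-touch (inj₂ refl)
    c-off : ¬ OnEdge X Y c
    c-off (on-edge _ _) = apart d (inj₁ refl) (inj₁ refl)
    s<φc : s < zeroOn G (onEdge? X Y) (distToEnds robber) c
    s<φc = subst (s <_) (sym (zeroOn-outside G (onEdge? X Y) c-off)) (s≤s (distToEnds-disjoint d))

  Safe : V → V → Set
  Safe c r = Disjoint c r × (IsMid c ⊎ IsMid r)

  module Robber (third : (a b : Fin n) → ∃ λ v → a ≢ v × b ≢ v) where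

    Escape : V → V → Set
    Escape c r = ∃ λ r' → Reach G (c ≢_) s r r' × Safe c r'

    untouched : ∀ c → ∃ λ y → ¬ Touches c y
    untouched (orig z) = let (v , z≢v , _) = third z z in v , z≢v
    untouched (mid a b _ _) = let (v , a≢v , b≢v) = third a b in v , [ a≢v , b≢v ]

    enter-edge : i ≢ j → ¬ Touches c i → ¬ Touches c j → ∃ λ r' → orig i ~ r' × Safe c r'
    enter-edge {i} {j} i≢j ¬ci ¬cj with FinP.<-cmp i j
    ... | tri< i<j _ _ = mid i j i<j F.zero , fwd (e-start i<j F.zero refl) , disjoint-mid ¬ci ¬cj , inj₂ is-mid
    ... | tri≈ _ i≡j _ = ⊥-elim (i≢j i≡j)
    ... | tri> _ _ j<i =
      mid j i j<i (fromℕ k) , bwd (e-end j<i (fromℕ k) toℕ-fromℕ+2≡s) , disjoint-mid ¬cj ¬ci , inj₂ is-mid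

    settle : ¬ Touches c y → ∃ λ r' → Reach G (c ≢_) 1 (orig y) r' × Safe c r'
    settle {orig w} {y} w≢y with third w y
    ... | v , w≢v , y≢v with enter-edge y≢v w≢y w≢v
    ... | r' , e , safe = r' , reach-edge G (untouched⇒≢ w≢y refl) e (disjoint⇒≢ (proj₁ safe)) , safe
    settle {mid _ _ _ _} ¬cy =
      orig _ , reach-stay G (untouched⇒≢ ¬cy refl) , disjoint-orig ¬cy , inj₁ is-mid

    run-then-settle : Reach G (c ≢_) (suc k) r (orig y) → ¬ Touches c y → Escape c r
    run-then-settle run ¬cy = let (r' , hop , safe) = settle ¬cy in
      r' , reach-weaken G (≤-reflexive (+-comm (suc k) 1)) (reach-trans G run hop) , safe

    flee-edge : ∀ {h t} → ¬ OnEdge X Y c → Escape c (mid X Y h t)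
    flee-edge {X} {Y} {c} {h} {t} off with touches? c X | touches? c Y
    ... | yes cX | yes cY = ⊥-elim (off (touches-both⇒onEdge h cX cY))
    ... | yes _  | no ¬cY = run-then-settle
      (reach-weaken G (m∸n≤m (suc k) (toℕ t)) (along-to-end h (untouched⇒≢ ¬cY refl) (off-edge⇒≢ off) t)) ¬cY
    ... | no ¬cX | yes _  = run-then-settle
      (reach-sym G (reach-weaken G (FinP.toℕ<n t) (along-from-start h (untouched⇒≢ ¬cX refl) (off-edge⇒≢ off) t))) ¬cX
    ... | no ¬cX | no ¬cY = mid X Y h t , reach-stay G (disjoint⇒≢ d) , d , inj₂ is-mid
      where
      d : Disjoint c (mid X Y h t)
      d = disjoint-mid ¬cX ¬cY

    cornered : c ≢ orig y → Touches c y → Escape c (orig y)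
    cornered {orig _} c≢y refl = ⊥-elim (c≢y refl)
    cornered {mid a b _ _} {y} c≢y cy with third a b
    ... | v , a≢v , b≢v = orig v , across y≢v c≢y (untouched⇒≢ ¬cv) , disjoint-orig ¬cv , inj₁ is-mid
      where
      ¬cv : ¬ (a ≡ v ⊎ b ≡ v)
      ¬cv = [ a≢v , b≢v ]
      y≢v : y ≢ v
      y≢v refl = ¬cv cy

    flee-branch : c ≢ orig y → Escape c (orig y)
    flee-branch {c} {y} c≢y with touches? c y
    ... | yes cy = cornered c≢y cy
    ... | no ¬cy = let (r' , hop , safe) = settle ¬cy in r' , reach-weaken G (s≤s z≤n) hop , safe

    respond : Safe c r → Reach G P s c w → Escape w r
    respond {r = mid _ _ _ _} (d , _) cop-move = flee-edge (cop-misses-edge d cop-move)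
    respond {r = orig _} (d , inj₁ c-mid) cop-move = flee-branch (cop-misses-branch c-mid d cop-move)
    respond {r = orig _} (_ , inj₂ ())

    robber-evades : ∀ {cs} → Safe (cs F.zero) r → ¬ CopsForce G s 1 cs r
    robber-evades safe (move cs' cop-moves outcome) with respond safe (cop-moves F.zero)
    ... | r' , run , safe' with outcome
    ... | inj₁ (F.zero , caught) = reach-source G run caught
    ... | inj₂ continue = robber-evades safe' (continue r' (reach-map G uncaught run))
      where
      uncaught : ∀ {x} → cs' F.zero ≢ x → ¬ Caught G cs' x
      uncaught ≢x (F.zero , ≡x) = ≢x ≡x

    one-cop-loses : ¬ CopsWin G s 1
    one-cop-loses (cs , strategy) with untouched (cs F.zero)
    ... | y , ¬cy with settle ¬cy
    ... | r , _ , safe with strategy r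
    ... | inj₁ (F.zero , caught) = disjoint⇒≢ (proj₁ safe) caught
    ... | inj₂ force = robber-evades safe force

proposition2p6 : (n s : ℕ) → 3 ≤ n → 2 ≤ s →
    CopNumber≡ (K n) 1 × CopNumberIs (Subdiv n s) s 2
proposition2p6 (suc n) (suc (suc k)) n≥3 (s≤s (s≤s _)) =
  complete-copNumber n , two-cops-win F.zero , fewer-lose
  where
  open Subdivision (suc n) k
  open Robber (avoid-two n≥3)
  fewer-lose : ∀ j → j < 2 → ¬ CopsWin G s j
  fewer-lose zero _ = no-cops-lose G (orig F.zero)
  fewer-lose (suc zero) _ = one-cop-loses
  fewer-lose (suc (suc _)) (s≤s (s≤s ()))
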